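{- Let $d\ge3$, $T\subset\mathbb R$ with $|T|=n\ge d+1$, and let $P_\sigma(T)$ be a Veronese $d$-polytope whose signed $\sigma$-decomposition partitions $T$ into $d+1$ intervals $T=I_1\cup\dots\cup I_{d+1}$. If $|I_1|=\dots=|I_d|=1$ and $|I_{d+1}|=n-d$, then $P_\sigma(T)$ is a $d$-dimensional simplex.
   Context: $\nu_d(t)=(1,t,\dots,t^d)$, $q_\xi(t)=\sum_{i=0}^d\xi_it^i$. A chamber $\sigma$ is the closure of a connected component of the complement in $\mathbb R^{d+1}$ of the hyperplanes $\{\xi:q_\xi(t)=0\}$, $t\in T$; $P_\sigma(T)=\mathrm{conv}\{\nu_d(t)/q_\xi(t):t\in T\}$ for any $\xi$ in the interior of $\sigma$ (combinatorial type independent of this choice). The signed $\sigma$-decomposition partitions $T$ into the maximal runs $I_1<I_2<\dots$ (in increasing order) of consecutive elements of $T$ on which $\mathrm{sgn}\,q_\xi$ is constant. -}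

module Defs where

open import Level using (0ℓ)
open import Data.Nat using (ℕ; zero; suc)
open import Data.Fin using (Fin; zero; suc)
open import Data.Bool using (Bool; true; false; if_then_else_)
open import Data.Bool.Properties using () renaming (_≟_ to _≟ᵇ_)
open import Data.List using (List; []; _∷_)
open import Data.Product using (Σ; ∃; _×_; _,_)
open import Data.Sum using (_⊎_)
open import Relation.Nullary using (¬_; does)
open import Relation.Binary using (Tri; tri<; tri≈; tri>)
open import Relation.Binary.Structures using (IsStrictTotalOrder)
open import Relation.Binary.PropositionalEquality using (_≡_; _≢_)
open import Algebra.Structures using (IsCommutativeRing)

-- A model of the real numbers: a complete ordered field (all such models are
-- isomorphic, so quantifying over them is the same as working in ℝ).
record Reals : Set₁ where
  infixl 6 _+_
  infixl 7 _*_
  infix 4 _<_ _≤_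
  field
    Carrier : Set
    _+_ _*_ : Carrier → Carrier → Carrier
    -_      : Carrier → Carrier
    0# 1#   : Carrier
    _⁻¹     : Carrier → Carrier
    _<_     : Carrier → Carrier → Set
    isCommutativeRing : IsCommutativeRing _≡_ _+_ _*_ -_ 0# 1#
    0≢1     : 0# ≢ 1#
    inverseʳ : ∀ x → x ≢ 0# → x * (x ⁻¹) ≡ 1#
    isStrictTotalOrder : IsStrictTotalOrder _≡_ _<_
    +-mono-< : ∀ x y z → x < y → x + z < y + z
    *-pos    : ∀ x y → 0# < x → 0# < y → 0# < x * y

  _≤_ : Carrier → Carrier → Set
  x ≤ y = (x < y) ⊎ (x ≡ y)

  field
    complete : (S : Carrier → Set) → (∃ λ x → S x) →
               (∃ λ b → ∀ x → S x → x ≤ b) →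
               ∃ λ s → (∀ x → S x → x ≤ s) × (∀ b → (∀ x → S x → x ≤ b) → s ≤ b)

module Geometry (R : Reals) where
  open Reals R

  ∑ : {m : ℕ} → (Fin m → Carrier) → Carrier
  ∑ {zero}  f = 0#
  ∑ {suc m} f = f zero + ∑ (λ i → f (suc i))

  _^_ : Carrier → ℕ → Carrier
  x ^ zero  = 1#
  x ^ suc k = x * (x ^ k)

  toN : {m : ℕ} → Fin m → ℕ
  toN zero    = zero
  toN (suc i) = suc (toN i)

  Pt : ℕ → Set
  Pt d = Fin (suc d) → Carrier

  ν : (d : ℕ) → Carrier → Pt d
  ν d t i = t ^ toN i

  q : {d : ℕ} → Pt d → Carrier → Carrier
  q {d} ξ t = ∑ (λ i → ξ i * (t ^ toN i))

  vpt : {d : ℕ} → Pt d → Carrier → Pt d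
  vpt {d} ξ t i = ν d t i * (q ξ t ⁻¹)

  InConv : {d m : ℕ} → (Fin m → Pt d) → Pt d → Set
  InConv {d} {m} p x = Σ (Fin m → Carrier) λ c →
    (∀ k → 0# ≤ c k) × (∑ c ≡ 1#) × (∀ j → x j ≡ ∑ (λ k → c k * p k j))

  AffinelyIndependent : {d k : ℕ} → (Fin k → Pt d) → Set
  AffinelyIndependent {d} {k} v = ∀ (c : Fin k → Carrier) →
    ∑ c ≡ 0# → (∀ j → ∑ (λ i → c i * v i j) ≡ 0#) → ∀ i → c i ≡ 0#

  IsDSimplex : (d : ℕ) {m : ℕ} → (Fin m → Pt d) → Set
  IsDSimplex d p = Σ (Fin (suc d) → Pt d) λ v →
    AffinelyIndependent v × (∀ x → (InConv p x → InConv v x) × (InConv v x → InConv p x))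

  positive : Carrier → Bool
  positive x with IsStrictTotalOrder.compare isStrictTotalOrder 0# x
  ... | tri< _ _ _ = true
  ... | tri≈ _ _ _ = false
  ... | tri> _ _ _ = false

  StrictlyIncreasing : {n : ℕ} → (Fin n → Carrier) → Set
  StrictlyIncreasing {n} t = ∀ (i j : Fin n) → toN i Data.Nat.< toN j → t i < t j

runLengthsFrom : Bool → ℕ → List Bool → List ℕ
runLengthsFrom cur k []       = k ∷ []
runLengthsFrom cur k (c ∷ cs) =
  if does (c ≟ᵇ cur) then runLengthsFrom cur (suc k) cs else k ∷ runLengthsFrom c 1 cs

runLengths : List Bool → List ℕ
runLengths []       = []
runLengths (b ∷ bs) = runLengthsFrom b 1 bs

{-# OPTIONS --safe #-}
module Submission where

-- Put r_i = t_{d-i}, so that r_0 > r_1 > … > r_d are the first d + 1 nodes in decreasing order.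
-- The sign pattern says that q_ξ alternates in sign along r_0, …, r_d and has the sign of
-- q_ξ(r_0) at every later node. The points ν(r_i)/q_ξ(r_i) are affinely independent (Vandermonde).
-- For a later node x > r_0, the Lagrange weights μ_i with f(x) = Σ μ_i f(r_i) for every f of
-- degree ≤ d alternate in sign, starting with μ_0 > 0. Applied to q_ξ and to the monomials they give
--   ν(x)/q_ξ(x) = Σ_i (μ_i q_ξ(r_i)/q_ξ(x)) · ν(r_i)/q_ξ(r_i),
-- whose coefficients sum to 1 and are nonnegative because the two alternations cancel. So the
-- polytope is the simplex spanned by the first d + 1 points.

open import Defs
open import Data.Nat using (ℕ; suc; _∸_) renaming (_≤_ to _≤ℕ_)
open import Data.Fin using (Fin)
open import Data.List using (List; _∷_; []; _++_; replicate; tabulate)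
open import Relation.Binary.PropositionalEquality using (_≡_; _≢_)

open import Algebra.Bundles using (CommutativeRing)
open import Data.Bool.Base using (Bool; true; false)
open import Data.Bool.Properties using () renaming (_≟_ to _≟ᵇ_)
open import Data.Empty using (⊥-elim)
open import Data.Fin.Base using (zero; suc; toℕ; fromℕ<)
open import Data.Fin.Properties using (toℕ-fromℕ<; toℕ-injective; toℕ≤pred[n]; suc-injective)
open import Data.Integer.Base as ℤ using (ℤ; -[1+_]; +[1+_]; _⊖_; _◃_; sign; ∣_∣)
open import Data.Integer.Properties using ([1+m]⊖[1+n]≡m⊖n; ◃-inverse) renaming (_≟_ to _≟ℤ_)
open import Data.List.Properties using (∷-injectiveʳ; ++-conicalʳ)
open import Data.Maybe.Base using (map)
open import Data.Nat.Base as ℕ using (zero; s≤s; z≤n)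
import Data.Nat.Properties as ℕ
open import Data.Product.Base using (Σ-syntax; _×_; _,_; proj₁; proj₂)
open import Data.Sign.Base as Sign using (Sign)
open import Data.Sum.Base using (inj₁; inj₂)
open import Function.Base using (_∘_)
open import Function.Definitions using (Injective)
open import Relation.Binary.Definitions using (tri<; tri≈; tri>)
open import Relation.Binary.Structures using (IsStrictTotalOrder)
open import Relation.Binary.PropositionalEquality
  using (refl; sym; trans; cong; cong₂; subst; subst₂; ≢-sym; module ≡-Reasoning)
open import Relation.Nullary using (yes; no)
open import Relation.Nullary.Decidable using (dec⇒maybe)
import Algebra.Solver.Ring
import Algebra.Solver.Ring.AlmostCommutativeRing as ACR

-- The solver needs coefficients whose normal forms are canonical, so that `refl` can compare
-- them although equality in R is undecidable; ℤ maps into every commutative ring.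
module IntegerCoefficients {c ℓ} (R : CommutativeRing c ℓ) where
  open CommutativeRing R renaming (refl to ≈-refl; sym to ≈-sym; trans to ≈-trans)
  open import Algebra.Properties.Ring ring using (-‿involutive; -0#≈0#; -‿+-comm; -1*x≈-x)
  -- the optimised multiple satisfies 1 × x = x definitionally, so ⟦ + 1 ⟧ℤ is 1#
  open import Algebra.Properties.Semiring.Mult.TCOptimised semiring
    using (1+×; ×-homo-+; ×1-homo-*) renaming (_×_ to _×′_)
  open import Algebra.Properties.CommutativeSemigroup +-commutativeSemigroup
    using () renaming (interchange to +-interchange)
  open import Algebra.Properties.CommutativeSemigroup *-commutativeSemigroup
    using () renaming (interchange to *-interchange)
  open import Relation.Binary.Reasoning.Setoid setoid

  ⟦_⟧ₛ : Sign → Carrier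
  ⟦ Sign.+ ⟧ₛ = 1#
  ⟦ Sign.- ⟧ₛ = - 1#

  ⟦_⟧ℤ : ℤ → Carrier
  ⟦ ℤ.+ n ⟧ℤ    = n ×′ 1#
  ⟦ -[1+ n ] ⟧ℤ = - (suc n ×′ 1#)

  ◃-homo : ∀ s n → ⟦ s ◃ n ⟧ℤ ≈ ⟦ s ⟧ₛ * (n ×′ 1#)
  ◃-homo s      zero    = ≈-sym (zeroʳ _)
  ◃-homo Sign.+ (suc n) = ≈-sym (*-identityˡ _)
  ◃-homo Sign.- (suc n) = ≈-sym (-1*x≈-x _)

  ⟦⟧ℤ-sign-abs : ∀ i → ⟦ i ⟧ℤ ≈ ⟦ sign i ⟧ₛ * (∣ i ∣ ×′ 1#)
  ⟦⟧ℤ-sign-abs i = ≈-trans (reflexive (cong ⟦_⟧ℤ (sym (◃-inverse i)))) (◃-homo (sign i) ∣ i ∣)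

  *ₛ-homo : ∀ s t → ⟦ s Sign.* t ⟧ₛ ≈ ⟦ s ⟧ₛ * ⟦ t ⟧ₛ
  *ₛ-homo Sign.+ t      = ≈-sym (*-identityˡ _)
  *ₛ-homo Sign.- Sign.+ = ≈-sym (*-identityʳ _)
  *ₛ-homo Sign.- Sign.- = ≈-sym (≈-trans (-1*x≈-x _) (-‿involutive _))

  *-homo : ∀ i j → ⟦ i ℤ.* j ⟧ℤ ≈ ⟦ i ⟧ℤ * ⟦ j ⟧ℤ
  *-homo i j = begin
    ⟦ (sign i Sign.* sign j) ◃ (∣ i ∣ ℕ.* ∣ j ∣) ⟧ℤ
      ≈⟨ ◃-homo (sign i Sign.* sign j) (∣ i ∣ ℕ.* ∣ j ∣) ⟩
    ⟦ sign i Sign.* sign j ⟧ₛ * ((∣ i ∣ ℕ.* ∣ j ∣) ×′ 1#)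
      ≈⟨ *-cong (*ₛ-homo (sign i) (sign j)) (×1-homo-* ∣ i ∣ ∣ j ∣) ⟩
    (⟦ sign i ⟧ₛ * ⟦ sign j ⟧ₛ) * ((∣ i ∣ ×′ 1#) * (∣ j ∣ ×′ 1#))
      ≈⟨ *-interchange _ _ _ _ ⟩
    (⟦ sign i ⟧ₛ * (∣ i ∣ ×′ 1#)) * (⟦ sign j ⟧ₛ * (∣ j ∣ ×′ 1#))
      ≈⟨ *-cong (⟦⟧ℤ-sign-abs i) (⟦⟧ℤ-sign-abs j) ⟨
    ⟦ i ⟧ℤ * ⟦ j ⟧ℤ ∎

  ⊖-homo : ∀ m n → ⟦ m ⊖ n ⟧ℤ ≈ m ×′ 1# - n ×′ 1#
  ⊖-homo m       zero    = ≈-sym (≈-trans (+-congˡ -0#≈0#) (+-identityʳ _))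
  ⊖-homo zero    (suc n) = ≈-sym (+-identityˡ _)
  ⊖-homo (suc m) (suc n) = begin
    ⟦ suc m ⊖ suc n ⟧ℤ                   ≡⟨ cong ⟦_⟧ℤ ([1+m]⊖[1+n]≡m⊖n m n) ⟩
    ⟦ m ⊖ n ⟧ℤ                           ≈⟨ ⊖-homo m n ⟩
    m ×′ 1# - n ×′ 1#                      ≈⟨ +-identityˡ _ ⟨
    0# + (m ×′ 1# - n ×′ 1#)               ≈⟨ +-congʳ (-‿inverseʳ 1#) ⟨
    (1# - 1#) + (m ×′ 1# - n ×′ 1#)        ≈⟨ +-interchange _ _ _ _ ⟩
    (1# + m ×′ 1#) + (- 1# + - (n ×′ 1#))  ≈⟨ +-congˡ (-‿+-comm _ _) ⟩
    (1# + m ×′ 1#) - (1# + n ×′ 1#)        ≈⟨ +-cong (1+× m 1#) (-‿cong (1+× n 1#)) ⟨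
    suc m ×′ 1# - suc n ×′ 1#              ∎

  +-homo : ∀ i j → ⟦ i ℤ.+ j ⟧ℤ ≈ ⟦ i ⟧ℤ + ⟦ j ⟧ℤ
  +-homo (ℤ.+ m) (ℤ.+ n)  = ×-homo-+ 1# m n
  +-homo (ℤ.+ m) -[1+ n ] = ⊖-homo m (suc n)
  +-homo -[1+ m ] (ℤ.+ n) = ≈-trans (⊖-homo n (suc m)) (+-comm _ _)
  +-homo -[1+ m ] -[1+ n ] = begin
    - (suc (suc (m ℕ.+ n)) ×′ 1#)     ≡⟨ cong (λ k → - (suc k ×′ 1#)) (ℕ.+-suc m n) ⟨
    - ((suc m ℕ.+ suc n) ×′ 1#)       ≈⟨ -‿cong (×-homo-+ 1# (suc m) (suc n)) ⟩
    - (suc m ×′ 1# + suc n ×′ 1#)      ≈⟨ -‿+-comm _ _ ⟨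
    - (suc m ×′ 1#) + - (suc n ×′ 1#)  ∎

  -‿homo : ∀ i → ⟦ ℤ.- i ⟧ℤ ≈ - ⟦ i ⟧ℤ
  -‿homo (ℤ.+ zero) = ≈-sym -0#≈0#
  -‿homo +[1+ n ] = ≈-refl
  -‿homo -[1+ n ] = ≈-sym (-‿involutive _)

  homomorphism : ℤ.+-*-rawRing ACR.-Raw-AlmostCommutative⟶ ACR.fromCommutativeRing R
  homomorphism = record
    { ⟦_⟧    = ⟦_⟧ℤ
    ; +-homo = +-homo
    ; *-homo = *-homo
    ; -‿homo = -‿homo
    ; 0-homo = ≈-refl
    ; 1-homo = ≈-refl
    }

  open Algebra.Solver.Ring ℤ.+-*-rawRing (ACR.fromCommutativeRing R) homomorphism
    (λ i j → map (reflexive ∘ cong ⟦_⟧ℤ) (dec⇒maybe (i ≟ℤ j))) public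

data Sgn : Set where
  neg nil pos : Sgn

opp : Sgn → Sgn
opp neg = pos
opp nil = nil
opp pos = neg

infixl 7 _·_

_·_ : Sgn → Sgn → Sgn
neg · s = opp s
nil · s = nil
pos · s = s

alt : ℕ → Sgn
alt zero    = pos
alt (suc k) = opp (alt k)

sgnᵇ : Bool → Sgn
sgnᵇ true  = pos
sgnᵇ false = neg

·-identityʳ : ∀ s → s · pos ≡ s
·-identityʳ neg = refl
·-identityʳ nil = refl
·-identityʳ pos = refl

·-neg : ∀ s → s · neg ≡ opp s
·-neg neg = refl
·-neg nil = refl
·-neg pos = refl

opp-· : ∀ s s′ → opp (s · s′) ≡ opp s · s′
opp-· neg neg = refl
opp-· neg nil = refl
opp-· neg pos = refl
opp-· nil s′  = refl
opp-· pos s′  = refl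

·≡pos⇒≡ : ∀ s s′ → s · s′ ≡ pos → s ≡ s′
·≡pos⇒≡ neg neg _ = refl
·≡pos⇒≡ pos pos _ = refl

≡·⇒≡pos : ∀ s → s ≡ s · s → s ≢ nil → s ≡ pos
≡·⇒≡pos neg ()
≡·⇒≡pos nil _ s≢nil = ⊥-elim (s≢nil refl)
≡·⇒≡pos pos _ _     = refl

·-square : ∀ s → s ≢ nil → s · s ≡ pos
·-square neg _     = refl
·-square nil s≢nil = ⊥-elim (s≢nil refl)
·-square pos _     = refl

·-cancelˡ : ∀ s s′ → s ≢ nil → s · (s · s′) ≡ s′
·-cancelˡ neg neg _     = refl
·-cancelˡ neg nil _     = refl
·-cancelˡ neg pos _     = refl
·-cancelˡ nil _   s≢nil = ⊥-elim (s≢nil refl)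
·-cancelˡ pos _   _     = refl

opp-≢nil : ∀ {s} → s ≢ nil → opp s ≢ nil
opp-≢nil {neg} _     ()
opp-≢nil {nil} s≢nil = s≢nil
opp-≢nil {pos} _     ()

alt≢nil : ∀ k → alt k ≢ nil
alt≢nil zero    ()
alt≢nil (suc k) = opp-≢nil (alt≢nil k)

sgnᵇ-≢ : ∀ {b b′} → b ≢ b′ → sgnᵇ b ≡ opp (sgnᵇ b′)
sgnᵇ-≢ {true}  {true}  b≢b′ = ⊥-elim (b≢b′ refl)
sgnᵇ-≢ {true}  {false} _    = refl
sgnᵇ-≢ {false} {true}  _    = refl
sgnᵇ-≢ {false} {false} b≢b′ = ⊥-elim (b≢b′ refl)

AlternatesUpTo : ∀ {a} {A : Set a} {n} → ℕ → (Fin n → A) → Set a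
AlternatesUpTo d b = ∀ i j → toℕ j ≡ suc (toℕ i) → toℕ j ℕ.≤ d → b j ≢ b i

ConstantFrom : ∀ {a} {A : Set a} {n} → ℕ → (Fin n → A) → Set a
ConstantFrom d b = ∀ k k′ → d ℕ.≤ toℕ k → d ℕ.≤ toℕ k′ → b k ≡ b k′

runLengthsFrom-nonempty : ∀ c k cs → runLengthsFrom c k cs ≢ []
runLengthsFrom-nonempty c k []        ()
runLengthsFrom-nonempty c k (c′ ∷ cs) with c′ ≟ᵇ c
... | yes _ = runLengthsFrom-nonempty c (suc k) cs
... | no _  = λ ()

runLengthsFrom-head : ∀ c k cs {h hs} → runLengthsFrom c k cs ≡ h ∷ hs → k ℕ.≤ h
runLengthsFrom-head c k []       refl = ℕ.≤-refl
runLengthsFrom-head c k (c′ ∷ cs) eq with c′ ≟ᵇ c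
... | yes _ = ℕ.<⇒≤ (runLengthsFrom-head c (suc k) cs eq)
runLengthsFrom-head c k (c′ ∷ cs) refl | no _ = ℕ.≤-refl

runLengthsFrom-single : ∀ c k {n} (b : Fin n → Bool) {h} →
  runLengthsFrom c k (tabulate b) ≡ h ∷ [] → ∀ i → b i ≡ c
runLengthsFrom-single c k {suc n} b eq i with b zero ≟ᵇ c
runLengthsFrom-single c k b eq zero    | yes b₀≡c = b₀≡c
runLengthsFrom-single c k b eq (suc i) | yes _    = runLengthsFrom-single c (suc k) (b ∘ suc) eq i
runLengthsFrom-single c k b eq i       | no _     =
  ⊥-elim (runLengthsFrom-nonempty (b zero) 1 (tabulate (b ∘ suc)) (∷-injectiveʳ eq))

runLengths-pattern : ∀ d {n} (b : Fin (suc n) → Bool) m →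
  runLengths (tabulate b) ≡ replicate d 1 ++ m ∷ [] → AlternatesUpTo d b × ConstantFrom d b
runLengths-pattern zero b m eq = (λ i j j≡ j≤0 → ⊥-elim (ℕ.1+n≢0 (trans (sym j≡) (ℕ.n≤0⇒n≡0 j≤0)))) ,
                                 (λ k k′ _ _ → trans (≡b₀ k) (sym (≡b₀ k′)))
  where
  ≡b₀ : ∀ k → b k ≡ b zero
  ≡b₀ zero    = refl
  ≡b₀ (suc k) = runLengthsFrom-single (b zero) 1 (b ∘ suc) eq k
runLengths-pattern (suc d) {zero} b m eq with ++-conicalʳ (replicate d 1) (m ∷ []) (sym (∷-injectiveʳ eq))
... | ()
runLengths-pattern (suc d) {suc n} b m eq with b (suc zero) ≟ᵇ b zero
... | yes _  = ⊥-elim (ℕ.1+n≰n (runLengthsFrom-head (b zero) 2 (tabulate (λ i → b (suc (suc i)))) eq))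
... | no b₁≢b₀ = alternates , constant
  where
  rest : AlternatesUpTo d (b ∘ suc) × ConstantFrom d (b ∘ suc)
  rest = runLengths-pattern d (b ∘ suc) m (∷-injectiveʳ eq)
  alternates : AlternatesUpTo (suc d) b
  alternates zero    (suc j) j≡ _         =
    subst (λ j → b (suc j) ≢ b zero) (sym (toℕ-injective (ℕ.suc-injective j≡))) b₁≢b₀
  alternates (suc i) (suc j) j≡ (s≤s j≤d) = proj₁ rest i j (ℕ.suc-injective j≡) j≤d
  constant : ConstantFrom (suc d) b
  constant (suc k) (suc k′) (s≤s d≤k) (s≤s d≤k′) = proj₂ rest k k′ d≤k d≤k′

corner : ∀ {d n} → d ℕ.≤ n → ℕ → Fin (suc n)
corner {d} d≤n k = fromℕ< (s≤s (ℕ.≤-trans (ℕ.m∸n≤m d k) d≤n))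

toℕ-corner : ∀ {d n} (d≤n : d ℕ.≤ n) k → toℕ (corner d≤n k) ≡ d ∸ k
toℕ-corner d≤n k = toℕ-fromℕ< _

corner-adjacent : ∀ {d n} (d≤n : d ℕ.≤ n) {k} → suc k ℕ.≤ d →
                  toℕ (corner d≤n k) ≡ suc (toℕ (corner d≤n (suc k)))
corner-adjacent {d} d≤n {k} k<d = begin
  toℕ (corner d≤n k)             ≡⟨ toℕ-corner d≤n k ⟩
  suc d ∸ suc k                  ≡⟨ ℕ.+-∸-assoc 1 k<d ⟩
  suc (d ∸ suc k)                ≡⟨ cong suc (toℕ-corner d≤n (suc k)) ⟨
  suc (toℕ (corner d≤n (suc k))) ∎
  where open ≡-Reasoning

corner-∸ : ∀ {d n} (d≤n : d ℕ.≤ n) (k : Fin (suc n)) → toℕ k ℕ.≤ d → corner d≤n (d ∸ toℕ k) ≡ k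
corner-∸ {d} d≤n k k≤d = toℕ-injective (trans (toℕ-corner d≤n (d ∸ toℕ k)) (ℕ.m∸[m∸n]≡n k≤d))

module Veronese (R : Reals) where
  open Reals R
  open Geometry R
  open IsStrictTotalOrder isStrictTotalOrder using (compare)
    renaming (irrefl to <-irrefl; asym to <-asym; trans to <-trans)
  open ≡-Reasoning

  commutativeRing : CommutativeRing _ _
  commutativeRing = record { isCommutativeRing = isCommutativeRing }

  open CommutativeRing commutativeRing
    using ( _-_; +-identityˡ; +-identityʳ; *-identityˡ; *-identityʳ; zeroˡ; zeroʳ; -‿inverseʳ; *-assoc
          ; semiring; ring)
  open import Algebra.Properties.Ring ring using (-‿involutive; -0#≈0#; x∙y⁻¹≈ε⇒x≈y)
  open IntegerCoefficients commutativeRing using (solve; _:=_; _:+_; _:-_; _:*_; :-_; con)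
  open import Algebra.Properties.Semiring.Sum semiring
    using (sum; sum-cong-≗; sum-replicate-zero; ∑-distrib-+; *-distribˡ-sum; *-distribʳ-sum)
    renaming (∑-comm to sum-comm)

  data Signum (x : Carrier) : Sgn → Set where
    is-neg : x < 0# → Signum x neg
    is-nil : x ≡ 0# → Signum x nil
    is-pos : 0# < x → Signum x pos

  signum : Carrier → Sgn
  signum x with compare 0# x
  ... | tri< _ _ _ = pos
  ... | tri≈ _ _ _ = nil
  ... | tri> _ _ _ = neg

  signum-correct : ∀ x → Signum x (signum x)
  signum-correct x with compare 0# x
  ... | tri< 0<x _ _ = is-pos 0<x
  ... | tri≈ _ 0≡x _ = is-nil (sym 0≡x)
  ... | tri> _ _ x<0 = is-neg x<0

  Signum-unique : ∀ {x s s′} → Signum x s → Signum x s′ → s ≡ s′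
  Signum-unique (is-neg _)   (is-neg _)   = refl
  Signum-unique (is-nil _)   (is-nil _)   = refl
  Signum-unique (is-pos _)   (is-pos _)   = refl
  Signum-unique (is-neg x<0) (is-nil x≡0) = ⊥-elim (<-irrefl x≡0 x<0)
  Signum-unique (is-neg x<0) (is-pos 0<x) = ⊥-elim (<-asym x<0 0<x)
  Signum-unique (is-nil x≡0) (is-neg x<0) = ⊥-elim (<-irrefl x≡0 x<0)
  Signum-unique (is-nil x≡0) (is-pos 0<x) = ⊥-elim (<-irrefl (sym x≡0) 0<x)
  Signum-unique (is-pos 0<x) (is-neg x<0) = ⊥-elim (<-asym x<0 0<x)
  Signum-unique (is-pos 0<x) (is-nil x≡0) = ⊥-elim (<-irrefl (sym x≡0) 0<x)

  signum-unique : ∀ {x s} → Signum x s → signum x ≡ s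
  signum-unique {x} = Signum-unique (signum-correct x)

  signum≡pos⇒0< : ∀ {x} → signum x ≡ pos → 0# < x
  signum≡pos⇒0< {x} eq with signum x | signum-correct x
  signum≡pos⇒0< refl | pos | is-pos 0<x = 0<x

  ≢0⇒signum≢nil : ∀ {x} → x ≢ 0# → signum x ≢ nil
  ≢0⇒signum≢nil {x} x≢0 eq with signum x | signum-correct x
  ≢0⇒signum≢nil x≢0 refl | nil | is-nil x≡0 = x≢0 x≡0

  signum-positive : ∀ {x} → x ≢ 0# → signum x ≡ sgnᵇ (positive x)
  signum-positive {x} x≢0 with compare 0# x
  ... | tri< _ _ _   = refl
  ... | tri≈ _ 0≡x _ = ⊥-elim (x≢0 (sym 0≡x))
  ... | tri> _ _ _   = refl

  0<-x : ∀ {x} → x < 0# → 0# < - x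
  0<-x {x} x<0 = subst₂ _<_ (-‿inverseʳ x) (+-identityˡ (- x)) (+-mono-< x 0# (- x) x<0)

  0<-x⇒x<0 : ∀ {x} → 0# < - x → x < 0#
  0<-x⇒x<0 {x} 0<-x = subst₂ _<_ (trans (+-identityˡ (- - x)) (-‿involutive x)) (-‿inverseʳ (- x))
                        (+-mono-< 0# (- x) (- - x) 0<-x)

  Signum-* : ∀ {x y s s′} → Signum x s → Signum y s′ → Signum (x * y) (s · s′)
  Signum-* {x} {y} (is-neg x<0) (is-neg y<0) =
    is-pos (subst (0# <_) (solve 2 (λ x y → (:- x) :* (:- y) := x :* y) refl x y) (*-pos _ _ (0<-x x<0) (0<-x y<0)))
  Signum-* {x} {y} (is-neg x<0) (is-pos 0<y) =
    is-neg (0<-x⇒x<0 (subst (0# <_) (solve 2 (λ x y → (:- x) :* y := :- (x :* y)) refl x y) (*-pos _ _ (0<-x x<0) 0<y)))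
  Signum-* {x} {y} (is-pos 0<x) (is-neg y<0) =
    is-neg (0<-x⇒x<0 (subst (0# <_) (solve 2 (λ x y → x :* (:- y) := :- (x :* y)) refl x y) (*-pos _ _ 0<x (0<-x y<0))))
  Signum-* {x} {y} (is-pos 0<x) (is-pos 0<y) = is-pos (*-pos _ _ 0<x 0<y)
  Signum-* {x} {y} (is-nil x≡0) _            = is-nil (trans (cong (_* y) x≡0) (zeroˡ y))
  Signum-* {x} {y} (is-neg _)   (is-nil y≡0) = is-nil (trans (cong (x *_) y≡0) (zeroʳ x))
  Signum-* {x} {y} (is-pos _)   (is-nil y≡0) = is-nil (trans (cong (x *_) y≡0) (zeroʳ x))

  signum-* : ∀ x y → signum (x * y) ≡ signum x · signum y
  signum-* x y = signum-unique (Signum-* (signum-correct x) (signum-correct y))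

  signum-1# : signum 1# ≡ pos
  signum-1# = ≡·⇒≡pos (signum 1#) (trans (cong signum (sym (*-identityˡ 1#))) (signum-* 1# 1#))
                (≢0⇒signum≢nil (λ 1≡0 → 0≢1 (sym 1≡0)))

  signum-⁻¹ : ∀ {x} → x ≢ 0# → signum (x ⁻¹) ≡ signum x
  signum-⁻¹ {x} x≢0 = sym (·≡pos⇒≡ (signum x) (signum (x ⁻¹)) (begin
    signum x · signum (x ⁻¹)  ≡⟨ signum-* x (x ⁻¹) ⟨
    signum (x * x ⁻¹)         ≡⟨ cong signum (inverseʳ x x≢0) ⟩
    signum 1#                 ≡⟨ signum-1# ⟩
    pos                       ∎))

  signum-[y-x] : ∀ {x y} → x < y → signum (y - x) ≡ pos
  signum-[y-x] {x} {y} x<y = signum-unique (is-pos (subst (_< y - x) (-‿inverseʳ x) (+-mono-< x y (- x) x<y)))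

  signum-[x-y] : ∀ {x y} → x < y → signum (x - y) ≡ neg
  signum-[x-y] {x} {y} x<y = signum-unique (is-neg (subst (x - y <_) (-‿inverseʳ y) (+-mono-< x y (- y) x<y)))

  x*y≡0⇒x≡0 : ∀ {x y} → x * y ≡ 0# → y ≢ 0# → x ≡ 0#
  x*y≡0⇒x≡0 {x} {y} xy≡0 y≢0 = begin
    x                ≡⟨ *-identityʳ x ⟨
    x * 1#           ≡⟨ cong (x *_) (inverseʳ y y≢0) ⟨
    x * (y * y ⁻¹)   ≡⟨ *-assoc x y (y ⁻¹) ⟨
    x * y * y ⁻¹     ≡⟨ cong (_* y ⁻¹) xy≡0 ⟩
    0# * y ⁻¹        ≡⟨ zeroˡ _ ⟩
    0#               ∎

  ⁻¹≢0 : ∀ {x} → x ≢ 0# → x ⁻¹ ≢ 0#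
  ⁻¹≢0 {x} x≢0 x⁻¹≡0 = 0≢1 (begin
    0#         ≡⟨ zeroʳ x ⟨
    x * 0#     ≡⟨ cong (x *_) x⁻¹≡0 ⟨
    x * x ⁻¹   ≡⟨ inverseʳ x x≢0 ⟩
    1#         ∎)

  0≤1 : 0# ≤ 1#
  0≤1 = inj₁ (signum≡pos⇒0< signum-1#)

  0≤-+ : ∀ {x y} → 0# ≤ x → 0# ≤ y → 0# ≤ x + y
  0≤-+ {x} {y} (inj₁ 0<x) (inj₁ 0<y) = inj₁ (<-trans 0<y (subst (_< x + y) (+-identityˡ y) (+-mono-< 0# x y 0<x)))
  0≤-+ {x} {y} (inj₂ 0≡x) 0≤y        = subst (0# ≤_) (trans (sym (+-identityˡ y)) (cong (_+ y) 0≡x)) 0≤y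
  0≤-+ {x} {y} 0≤x        (inj₂ 0≡y) = subst (0# ≤_) (trans (sym (+-identityʳ x)) (cong (x +_) 0≡y)) 0≤x

  0≤-* : ∀ {x y} → 0# ≤ x → 0# ≤ y → 0# ≤ x * y
  0≤-* {x} {y} (inj₁ 0<x) (inj₁ 0<y) = inj₁ (*-pos x y 0<x 0<y)
  0≤-* {x} {y} (inj₂ 0≡x) _          = inj₂ (sym (trans (cong (_* y) (sym 0≡x)) (zeroˡ y)))
  0≤-* {x} {y} _          (inj₂ 0≡y) = inj₂ (sym (trans (cong (x *_) (sym 0≡y)) (zeroʳ x)))

  ∑≡sum : ∀ {m} (f : Fin m → Carrier) → ∑ f ≡ sum f
  ∑≡sum {zero}  f = refl
  ∑≡sum {suc m} f = cong (f zero +_) (∑≡sum (f ∘ suc))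

  ∑-cong : ∀ {m} {f g : Fin m → Carrier} → (∀ i → f i ≡ g i) → ∑ f ≡ ∑ g
  ∑-cong {f = f} {g} f≗g = trans (∑≡sum f) (trans (sum-cong-≗ f≗g) (sym (∑≡sum g)))

  ∑-zero : ∀ m → ∑ {m} (λ _ → 0#) ≡ 0#
  ∑-zero m = trans (∑≡sum {m} (λ _ → 0#)) (sum-replicate-zero m)

  ∑-+ : ∀ {m} (f g : Fin m → Carrier) → ∑ (λ i → f i + g i) ≡ ∑ f + ∑ g
  ∑-+ f g = trans (∑≡sum (λ i → f i + g i)) (trans (∑-distrib-+ f g) (sym (cong₂ _+_ (∑≡sum f) (∑≡sum g))))

  ∑-*ˡ : ∀ {m} c (f : Fin m → Carrier) → ∑ (λ i → c * f i) ≡ c * ∑ f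
  ∑-*ˡ c f = trans (∑≡sum (λ i → c * f i)) (sym (trans (cong (c *_) (∑≡sum f)) (*-distribˡ-sum c f)))

  ∑-*ʳ : ∀ {m} c (f : Fin m → Carrier) → ∑ (λ i → f i * c) ≡ ∑ f * c
  ∑-*ʳ c f = trans (∑≡sum (λ i → f i * c)) (sym (trans (cong (_* c) (∑≡sum f)) (*-distribʳ-sum c f)))

  ∑-comm : ∀ {m k} (f : Fin m → Fin k → Carrier) → ∑ (λ i → ∑ (f i)) ≡ ∑ (λ j → ∑ (λ i → f i j))
  ∑-comm f = begin
    ∑ (λ i → ∑ (f i))
      ≡⟨ trans (∑-cong (λ i → ∑≡sum (f i))) (∑≡sum (λ i → sum (f i))) ⟩
    sum (λ i → sum (f i))
      ≡⟨ sum-comm f ⟩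
    sum (λ j → sum (λ i → f i j))
      ≡⟨ trans (∑-cong (λ j → ∑≡sum (λ i → f i j))) (∑≡sum (λ j → sum (λ i → f i j))) ⟨
    ∑ (λ j → ∑ (λ i → f i j)) ∎

  ∑-nonneg : ∀ {m} (f : Fin m → Carrier) → (∀ i → 0# ≤ f i) → 0# ≤ ∑ f
  ∑-nonneg {zero}  f _     = inj₂ refl
  ∑-nonneg {suc m} f 0≤f = 0≤-+ (0≤f zero) (∑-nonneg (f ∘ suc) (0≤f ∘ suc))

  -- deg f ≤ m via divided differences, so that no coefficient representation of polynomials is needed
  Degree≤ : ℕ → (Carrier → Carrier) → Set
  Degree≤ zero    f = ∀ x y → f x ≡ f y
  Degree≤ (suc m) f = ∀ a → Σ[ g ∈ (Carrier → Carrier) ] Degree≤ m g × (∀ y → f y ≡ f a + (y - a) * g y)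

  Degree≤-cong : ∀ {m f g} → (∀ y → f y ≡ g y) → Degree≤ m f → Degree≤ m g
  Degree≤-cong {zero}  f≗g df x y = trans (sym (f≗g x)) (trans (df x y) (f≗g y))
  Degree≤-cong {suc m} f≗g df a with df a
  ... | h , dh , f≡ = h , dh , λ y → trans (sym (f≗g y)) (trans (f≡ y) (cong (_+ (y - a) * h y) (f≗g a)))

  Degree≤-const : ∀ m c → Degree≤ m (λ _ → c)
  Degree≤-const zero    c x y = refl
  Degree≤-const (suc m) c a   =
    (λ _ → 0#) , Degree≤-const m 0# , λ y → sym (trans (cong (c +_) (zeroʳ (y - a))) (+-identityʳ c))

  Degree≤-suc : ∀ {m f} → Degree≤ m f → Degree≤ (suc m) f
  Degree≤-suc {zero}  {f} df = Degree≤-cong {1} (df 0#) (Degree≤-const 1 (f 0#))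
  Degree≤-suc {suc m}     df a with df a
  ... | g , dg , f≡ = g , Degree≤-suc dg , f≡

  Degree≤-mono : ∀ {m k f} → m ℕ.≤ k → Degree≤ m f → Degree≤ k f
  Degree≤-mono m≤k = go (ℕ.≤⇒≤′ m≤k)
    where
    go : ∀ {m k f} → m ℕ.≤′ k → Degree≤ m f → Degree≤ k f
    go ℕ.≤′-refl        df = df
    go (ℕ.≤′-step m≤′k) df = Degree≤-suc (go m≤′k df)

  Degree≤-+ : ∀ {m f g} → Degree≤ m f → Degree≤ m g → Degree≤ m (λ y → f y + g y)
  Degree≤-+ {zero}          df dg x y = cong₂ _+_ (df x y) (dg x y)
  Degree≤-+ {suc m} {f} {g} df dg a with df a | dg a
  ... | f′ , df′ , f≡ | g′ , dg′ , g≡ = (λ y → f′ y + g′ y) , Degree≤-+ df′ dg′ , λ y → begin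
    f y + g y                                               ≡⟨ cong₂ _+_ (f≡ y) (g≡ y) ⟩
    (f a + (y - a) * f′ y) + (g a + (y - a) * g′ y)         ≡⟨ solve 6 (λ fa ga y a f′ g′ →
       (fa :+ (y :- a) :* f′) :+ (ga :+ (y :- a) :* g′) := (fa :+ ga) :+ (y :- a) :* (f′ :+ g′))
       refl (f a) (g a) y a (f′ y) (g′ y) ⟩
    (f a + g a) + (y - a) * (f′ y + g′ y)                   ∎

  Degree≤-scale : ∀ {m f} c → Degree≤ m f → Degree≤ m (λ y → c * f y)
  Degree≤-scale {zero}      c df x y = cong (c *_) (df x y)
  Degree≤-scale {suc m} {f} c df a with df a
  ... | g , dg , f≡ = (λ y → c * g y) , Degree≤-scale c dg , λ y → begin
    c * f y
      ≡⟨ cong (c *_) (f≡ y) ⟩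
    c * (f a + (y - a) * g y)
      ≡⟨ solve 5 (λ c fa y a g → c :* (fa :+ (y :- a) :* g) := c :* fa :+ (y :- a) :* (c :* g))
        refl c (f a) y a (g y) ⟩
    c * f a + (y - a) * (c * g y) ∎

  Degree≤-linear-* : ∀ {m g} b → Degree≤ m g → Degree≤ (suc m) (λ y → (y - b) * g y)
  Degree≤-linear-* {zero}  {g} b dg a = g , dg , λ y → begin
    (y - b) * g y
      ≡⟨ solve 4 (λ y a b g → (y :- b) :* g := (a :- b) :* g :+ (y :- a) :* g) refl y a b (g y) ⟩
    (a - b) * g y + (y - a) * g y
      ≡⟨ cong (λ u → (a - b) * u + (y - a) * g y) (dg y a) ⟩
    (a - b) * g a + (y - a) * g y ∎
  Degree≤-linear-* {suc m} {g} b dg a with dg a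
  ... | h , dh , g≡ = (λ y → g y + (a - b) * h y) , dk , expand
    where
    dk : Degree≤ (suc m) (λ y → g y + (a - b) * h y)
    dk = Degree≤-+ {suc m} dg (Degree≤-scale {suc m} (a - b) (Degree≤-suc dh))

    expand : ∀ y → (y - b) * g y ≡ (a - b) * g a + (y - a) * (g y + (a - b) * h y)
    expand y = begin
      (y - b) * g y
        ≡⟨ cong ((y - b) *_) (g≡ y) ⟩
      (y - b) * (g a + (y - a) * h y)
        ≡⟨ solve 5 (λ y a b ga h →
          (y :- b) :* (ga :+ (y :- a) :* h) := (a :- b) :* ga :+ (y :- a) :* ((ga :+ (y :- a) :* h) :+ (a :- b) :* h))
          refl y a b (g a) (h y) ⟩
      (a - b) * g a + (y - a) * ((g a + (y - a) * h y) + (a - b) * h y)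
        ≡⟨ cong (λ u → (a - b) * g a + (y - a) * (u + (a - b) * h y)) (g≡ y) ⟨
      (a - b) * g a + (y - a) * (g y + (a - b) * h y) ∎

  Degree≤-^ : ∀ j → Degree≤ j (_^ j)
  Degree≤-^ zero    x y = refl
  Degree≤-^ (suc j)     = Degree≤-cong {suc j} y-0≡y (Degree≤-linear-* 0# (Degree≤-^ j))
    where
    y-0≡y : ∀ y → (y - 0#) * y ^ j ≡ y * y ^ j
    y-0≡y y = cong (_* y ^ j) (trans (cong (y +_) -0#≈0#) (+-identityʳ y))

  Degree≤-∑ : ∀ {m k} (F : Fin k → Carrier → Carrier) → (∀ i → Degree≤ m (F i)) →
              Degree≤ m (λ y → ∑ (λ i → F i y))
  Degree≤-∑ {m} {zero}  F _  = Degree≤-const m 0#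
  Degree≤-∑ {m} {suc k} F dF = Degree≤-+ (dF zero) (Degree≤-∑ (F ∘ suc) (dF ∘ suc))

  toN≡toℕ : ∀ {k} (i : Fin k) → toN i ≡ toℕ i
  toN≡toℕ zero    = refl
  toN≡toℕ (suc i) = cong suc (toN≡toℕ i)

  toN≤pred : ∀ {d} (i : Fin (suc d)) → toN i ℕ.≤ d
  toN≤pred i = subst (ℕ._≤ _) (sym (toN≡toℕ i)) (toℕ≤pred[n] i)

  Degree≤-q : ∀ {d} (ξ : Pt d) → Degree≤ d (q ξ)
  Degree≤-q {d} ξ = Degree≤-∑ {d} _ (λ i → Degree≤-scale (ξ i) (Degree≤-mono (toN≤pred i) (Degree≤-^ (toN i))))

  ∏[y-_] : ∀ {k} → (Fin k → Carrier) → Carrier → Carrier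
  ∏[y-_] {zero}  s y = 1#
  ∏[y-_] {suc k} s y = (y - s zero) * ∏[y- s ∘ suc ] y

  Degree≤-∏ : ∀ {k} (s : Fin k → Carrier) → Degree≤ k ∏[y- s ]
  Degree≤-∏ {zero}  s x y = refl
  Degree≤-∏ {suc k} s     = Degree≤-linear-* (s zero) (Degree≤-∏ (s ∘ suc))

  ∏-root : ∀ {k} (s : Fin k → Carrier) i → ∏[y- s ] (s i) ≡ 0#
  ∏-root s zero    = trans (cong (_* ∏[y- s ∘ suc ] (s zero)) (-‿inverseʳ (s zero))) (zeroˡ _)
  ∏-root s (suc i) = trans (cong ((s (suc i) - s zero) *_) (∏-root (s ∘ suc) i)) (zeroʳ _)

  signum-∏ : ∀ {k} (s : Fin k → Carrier) y → (∀ i → s i < y) → signum (∏[y- s ] y) ≡ pos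
  signum-∏ {zero}  s y _     = signum-1#
  signum-∏ {suc k} s y s<y = begin
    signum ((y - s zero) * ∏[y- s ∘ suc ] y)
      ≡⟨ signum-* _ _ ⟩
    signum (y - s zero) · signum (∏[y- s ∘ suc ] y)
      ≡⟨ cong₂ _·_ (signum-[y-x] (s<y zero)) (signum-∏ (s ∘ suc) y (s<y ∘ suc)) ⟩
    pos ∎

  StrictlyDecreasing : ∀ {n} → (Fin n → Carrier) → Set
  StrictlyDecreasing {n} r = ∀ (i j : Fin n) → toℕ i ℕ.< toℕ j → r j < r i

  Interpolates : ∀ {m} → (Fin (suc m) → Carrier) → Carrier → (Fin (suc m) → Carrier) → Set
  Interpolates {m} r x μ = ∀ f → Degree≤ m f → ∑ (λ i → μ i * f (r i)) ≡ f x

  Alternating : ∀ {m} → (Fin m → Carrier) → Set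
  Alternating μ = ∀ i → signum (μ i) ≡ alt (toℕ i)

  interpolation-step : ∀ {m} (r : Fin (suc (suc m)) → Carrier) {x} → StrictlyDecreasing r → r zero < x →
    (ν : Fin (suc m) → Carrier) → Interpolates (r ∘ suc) x ν → Alternating ν →
    Σ[ μ ∈ (Fin (suc (suc m)) → Carrier) ] Interpolates r x μ × Alternating μ
  interpolation-step {m} r {x} r↓ r₀<x ν ν-interpolates ν-alternates = μ , interpolates , alternates
    where
    r₀ X : Carrier
    r₀ = r zero
    X  = x - r₀

    r₊<r₀ : ∀ i → r (suc i) < r₀
    r₊<r₀ i = r↓ zero (suc i) (s≤s z≤n)

    D : Fin (suc m) → Carrier
    D i = r (suc i) - r₀

    D≢0 : ∀ i → D i ≢ 0#
    D≢0 i D≡0 with trans (sym (signum-[x-y] (r₊<r₀ i))) (signum-unique (is-nil D≡0))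
    ... | ()

    -- f(y) = f(r₀) + (y - r₀) g(y): the weights ν interpolate the divided difference g at x,
    -- and μ zero makes the weights sum to 1
    μ₊ : Fin (suc m) → Carrier
    μ₊ i = ν i * X * D i ⁻¹

    μ : Fin (suc (suc m)) → Carrier
    μ zero    = 1# - ∑ μ₊
    μ (suc i) = μ₊ i

    term : ∀ i F G → μ₊ i * (F + D i * G) ≡ μ₊ i * F + X * (ν i * G)
    term i F G = begin
      ν i * X * D i ⁻¹ * (F + D i * G)
        ≡⟨ solve 6 (λ ν X D⁻¹ F D G →
          ν :* X :* D⁻¹ :* (F :+ D :* G) := ν :* X :* D⁻¹ :* F :+ X :* (ν :* G) :* (D :* D⁻¹))
          refl (ν i) X (D i ⁻¹) F (D i) G ⟩
      μ₊ i * F + X * (ν i * G) * (D i * D i ⁻¹)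
        ≡⟨ cong (λ u → μ₊ i * F + X * (ν i * G) * u) (inverseʳ (D i) (D≢0 i)) ⟩
      μ₊ i * F + X * (ν i * G) * 1#
        ≡⟨ cong (μ₊ i * F +_) (*-identityʳ _) ⟩
      μ₊ i * F + X * (ν i * G) ∎

    tail-sum : ∀ f g → Degree≤ m g → (∀ y → f y ≡ f r₀ + (y - r₀) * g y) →
               ∑ (λ i → μ₊ i * f (r (suc i))) ≡ ∑ μ₊ * f r₀ + X * g x
    tail-sum f g dg f≡ = begin
      ∑ (λ i → μ₊ i * f (r (suc i)))
        ≡⟨ ∑-cong (λ i →
          trans (cong (μ₊ i *_) (f≡ (r (suc i)))) (term i (f r₀) (g (r (suc i))))) ⟩
      ∑ (λ i → μ₊ i * f r₀ + X * (ν i * g (r (suc i))))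
        ≡⟨ ∑-+ (λ i → μ₊ i * f r₀) (λ i → X * (ν i * g (r (suc i)))) ⟩
      ∑ (λ i → μ₊ i * f r₀) + ∑ (λ i → X * (ν i * g (r (suc i))))
        ≡⟨ cong₂ _+_ (∑-*ʳ (f r₀) μ₊) (∑-*ˡ X (λ i → ν i * g (r (suc i)))) ⟩
      ∑ μ₊ * f r₀ + X * ∑ (λ i → ν i * g (r (suc i)))
        ≡⟨ cong (λ u → ∑ μ₊ * f r₀ + X * u) (ν-interpolates g dg) ⟩
      ∑ μ₊ * f r₀ + X * g x ∎

    interpolates : Interpolates r x μ
    interpolates f df with df r₀
    ... | g , dg , f≡ = begin
      (1# - ∑ μ₊) * f r₀ + ∑ (λ i → μ₊ i * f (r (suc i)))
        ≡⟨ cong ((1# - ∑ μ₊) * f r₀ +_) (tail-sum f g dg f≡) ⟩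
      (1# - ∑ μ₊) * f r₀ + (∑ μ₊ * f r₀ + X * g x)
        ≡⟨ solve 4 (λ S F X G →
          (con (ℤ.+ 1) :- S) :* F :+ (S :* F :+ X :* G) := F :+ X :* G) refl (∑ μ₊) (f r₀) X (g x) ⟩
      f r₀ + X * g x
        ≡⟨ f≡ x ⟨
      f x ∎

    head-positive : signum (1# - ∑ μ₊) ≡ pos
    head-positive = begin
      signum (1# - ∑ μ₊)
        ≡⟨ ·-identityʳ _ ⟨
      signum (1# - ∑ μ₊) · pos
        ≡⟨ cong (signum (1# - ∑ μ₊) ·_) (signum-∏ (r ∘ suc) r₀ r₊<r₀) ⟨
      signum (1# - ∑ μ₊) · signum (P r₀)
        ≡⟨ signum-* _ _ ⟨
      signum ((1# - ∑ μ₊) * P r₀)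
        ≡⟨ cong signum head-term ⟩
      signum (P x)
        ≡⟨ signum-∏ (r ∘ suc) x (λ i → <-trans (r₊<r₀ i) r₀<x) ⟩
      pos ∎
      where
      P : Carrier → Carrier
      P = ∏[y- r ∘ suc ]
      -- P vanishes at every node but r₀, so interpolating P leaves only the head term
      head-term : (1# - ∑ μ₊) * P r₀ ≡ P x
      head-term = begin
        (1# - ∑ μ₊) * P r₀
          ≡⟨ +-identityʳ _ ⟨
        (1# - ∑ μ₊) * P r₀ + 0#
          ≡⟨ cong ((1# - ∑ μ₊) * P r₀ +_) (trans
            (∑-cong (λ i → trans (cong (μ₊ i *_) (∏-root (r ∘ suc) i)) (zeroʳ _))) (∑-zero (suc m))) ⟨
        (1# - ∑ μ₊) * P r₀ + ∑ (λ i → μ₊ i * P (r (suc i)))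
          ≡⟨ interpolates P (Degree≤-∏ (r ∘ suc)) ⟩
        P x ∎

    alternates : Alternating μ
    alternates zero    = head-positive
    alternates (suc i) = begin
      signum (ν i * X * D i ⁻¹)
        ≡⟨ trans (signum-* _ _) (cong (_· signum (D i ⁻¹)) (signum-* _ _)) ⟩
      signum (ν i) · signum X · signum (D i ⁻¹)
        ≡⟨ cong₂ _·_ (cong₂ _·_ (ν-alternates i) (signum-[y-x] r₀<x))
          (trans (signum-⁻¹ (D≢0 i)) (signum-[x-y] (r₊<r₀ i))) ⟩
      alt (toℕ i) · pos · neg
        ≡⟨ cong (_· neg) (·-identityʳ (alt (toℕ i))) ⟩
      alt (toℕ i) · neg
        ≡⟨ ·-neg (alt (toℕ i)) ⟩
      opp (alt (toℕ i)) ∎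

  interpolation : ∀ m (r : Fin (suc m) → Carrier) {x} → StrictlyDecreasing r → r zero < x →
    Σ[ μ ∈ (Fin (suc m) → Carrier) ] Interpolates r x μ × Alternating μ
  interpolation zero    r {x} _  _    = (λ _ → 1#) , interpolates , λ { zero → signum-1# }
    where
    interpolates : Interpolates r x (λ _ → 1#)
    interpolates f f-const = trans (+-identityʳ _) (trans (*-identityˡ _) (f-const (r zero) x))
  interpolation (suc m) r r↓ r₀<x
    with interpolation m (r ∘ suc) (λ i j i<j → r↓ (suc i) (suc j) (s≤s i<j))
                       (<-trans (r↓ zero (suc zero) (s≤s z≤n)) r₀<x)
  ... | ν , ν-interpolates , ν-alternates = interpolation-step r r↓ r₀<x ν ν-interpolates ν-alternates

  vandermonde : ∀ m (r : Fin (suc m) → Carrier) → Injective _≡_ _≡_ r → (c : Fin (suc m) → Carrier) →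
    (∀ j → j ℕ.≤ m → ∑ (λ i → c i * r i ^ j) ≡ 0#) → ∀ i → c i ≡ 0#
  vandermonde zero    r _           c moments zero = trans (sym (trans (+-identityʳ _) (*-identityʳ _))) (moments 0 z≤n)
  vandermonde (suc m) r r-injective c moments      = c≡0
    where
    D : Fin (suc m) → Carrier
    D i = r (suc i) - r zero

    D≢0 : ∀ i → D i ≢ 0#
    D≢0 i D≡0 with r-injective (x∙y⁻¹≈ε⇒x≈y _ _ D≡0)
    ... | ()

    -- multiplying by y - r₀ kills the node r₀ and lowers the number of moment conditions by one
    shifted : ∀ j → j ℕ.≤ m → ∑ (λ i → c (suc i) * D i * r (suc i) ^ j) ≡ 0#
    shifted j j≤m = begin
      ∑ (λ i → c (suc i) * D i * r (suc i) ^ j)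
        ≡⟨ +-identityˡ _ ⟨
      0# + ∑ (λ i → c (suc i) * D i * r (suc i) ^ j)
        ≡⟨ cong (_+ ∑ (λ i → c (suc i) * D i * r (suc i) ^ j)) r₀-term ⟨
      ∑ (λ i → c i * (r i - r zero) * r i ^ j)
        ≡⟨ ∑-cong (λ i → solve 4 (λ c rᵢ r₀ P →
          c :* (rᵢ :- r₀) :* P := c :* (rᵢ :* P) :+ (:- r₀) :* (c :* P)) refl (c i) (r i) (r zero) (r i ^ j)) ⟩
      ∑ (λ i → c i * r i ^ suc j + - r zero * (c i * r i ^ j))
        ≡⟨ ∑-+ (λ i → c i * r i ^ suc j) (λ i → - r zero * (c i * r i ^ j)) ⟩
      ∑ (λ i → c i * r i ^ suc j) + ∑ (λ i → - r zero * (c i * r i ^ j))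
        ≡⟨ cong₂ _+_ (moments (suc j) (s≤s j≤m))
          (∑-*ˡ (- r zero) (λ i → c i * r i ^ j)) ⟩
      0# + - r zero * ∑ (λ i → c i * r i ^ j)
        ≡⟨ cong (λ u → 0# + - r zero * u) (moments j (ℕ.m≤n⇒m≤1+n j≤m)) ⟩
      0# + - r zero * 0#
        ≡⟨ trans (+-identityˡ _) (zeroʳ _) ⟩
      0# ∎
      where
      r₀-term : c zero * (r zero - r zero) * r zero ^ j ≡ 0#
      r₀-term = trans (cong (λ u → c zero * u * r zero ^ j) (-‿inverseʳ (r zero)))
                      (trans (cong (_* r zero ^ j) (zeroʳ _)) (zeroˡ _))

    c₊≡0 : ∀ i → c (suc i) ≡ 0#
    c₊≡0 i = x*y≡0⇒x≡0 (vandermonde m (r ∘ suc) (suc-injective ∘ r-injective) (λ i → c (suc i) * D i) shifted i)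
                       (D≢0 i)

    c≡0 : ∀ i → c i ≡ 0#
    c≡0 (suc i) = c₊≡0 i
    c≡0 zero    = begin
      c zero                                   ≡⟨ *-identityʳ _ ⟨
      c zero * 1#                              ≡⟨ +-identityʳ _ ⟨
      c zero * 1# + 0#                         ≡⟨ cong (c zero * 1# +_) (trans
        (∑-cong (λ i → trans (cong (_* 1#) (c₊≡0 i)) (zeroˡ 1#))) (∑-zero (suc m))) ⟨
      c zero * 1# + ∑ (λ i → c (suc i) * 1#)   ≡⟨ moments 0 z≤n ⟩
      0#                                       ∎

  δ : ∀ {m} → Fin m → Fin m → Carrier
  δ zero    zero    = 1#
  δ zero    (suc _) = 0#
  δ (suc _) zero    = 0#
  δ (suc i) (suc k) = δ i k

  δ-nonneg : ∀ {m} (i k : Fin m) → 0# ≤ δ i k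
  δ-nonneg zero    zero    = 0≤1
  δ-nonneg zero    (suc _) = inj₂ refl
  δ-nonneg (suc _) zero    = inj₂ refl
  δ-nonneg (suc i) (suc k) = δ-nonneg i k

  ∑-δ : ∀ {m} (i : Fin m) (h : Fin m → Carrier) → ∑ (λ k → δ i k * h k) ≡ h i
  ∑-δ {suc m} zero    h = trans (cong₂ _+_ (*-identityˡ _) (trans (∑-cong (λ k → zeroˡ (h (suc k)))) (∑-zero m)))
                                (+-identityʳ _)
  ∑-δ         (suc i) h = trans (cong₂ _+_ (zeroˡ _) (∑-δ i (h ∘ suc))) (+-identityˡ _)

  InConv-vertex : ∀ {d m} (p : Fin m → Pt d) i → InConv p (p i)
  InConv-vertex p i = δ i , δ-nonneg i , trans (∑-cong (λ k → sym (*-identityʳ (δ i k)))) (∑-δ i (λ _ → 1#)) ,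
                      λ j → sym (∑-δ i (λ k → p k j))

  InConv-trans : ∀ {d a b} (P : Fin a → Pt d) (V : Fin b → Pt d) → (∀ k → InConv V (P k)) →
                 ∀ {y} → InConv P y → InConv V y
  InConv-trans {d} {a} {b} P V P⊆V {y} (c , c≥0 , ∑c≡1 , y≡) = c′ , c′≥0 , ∑c′≡1 , y≡′
    where
    A : Fin a → Fin b → Carrier
    A k = proj₁ (P⊆V k)

    c′ : Fin b → Carrier
    c′ i = ∑ (λ k → c k * A k i)

    c′≥0 : ∀ i → 0# ≤ c′ i
    c′≥0 i = ∑-nonneg _ (λ k → 0≤-* (c≥0 k) (proj₁ (proj₂ (P⊆V k)) i))

    ∑c′≡1 : ∑ c′ ≡ 1#
    ∑c′≡1 = begin
      ∑ (λ i → ∑ (λ k → c k * A k i))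
        ≡⟨ ∑-comm (λ k i → c k * A k i) ⟨
      ∑ (λ k → ∑ (λ i → c k * A k i))
        ≡⟨ ∑-cong (λ k → trans (∑-*ˡ (c k) (A k))
          (trans (cong (c k *_) (proj₁ (proj₂ (proj₂ (P⊆V k))))) (*-identityʳ _))) ⟩
      ∑ c
        ≡⟨ ∑c≡1 ⟩
      1# ∎

    y≡′ : ∀ j → y j ≡ ∑ (λ i → c′ i * V i j)
    y≡′ j = begin
      y j
        ≡⟨ y≡ j ⟩
      ∑ (λ k → c k * P k j)
        ≡⟨ ∑-cong (λ k → cong (c k *_) (proj₂ (proj₂ (proj₂ (P⊆V k))) j)) ⟩
      ∑ (λ k → c k * ∑ (λ i → A k i * V i j))
        ≡⟨ ∑-cong (λ k → trans (∑-cong (λ i → *-assoc (c k) (A k i) (V i j)))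
          (∑-*ˡ (c k) (λ i → A k i * V i j))) ⟨
      ∑ (λ k → ∑ (λ i → c k * A k i * V i j))
        ≡⟨ ∑-comm (λ k i → c k * A k i * V i j) ⟩
      ∑ (λ i → ∑ (λ k → c k * A k i * V i j))
        ≡⟨ ∑-cong (λ i → ∑-*ʳ (V i j) (λ k → c k * A k i)) ⟩
      ∑ (λ i → c′ i * V i j) ∎

  IsDSimplex-intro : ∀ {d m} (p : Fin m → Pt d) (v : Fin (suc d) → Pt d) → AffinelyIndependent v →
    (∀ i → InConv p (v i)) → (∀ k → InConv v (p k)) → IsDSimplex d p
  IsDSimplex-intro p v v-independent v⊆p p⊆v =
    v , v-independent , λ _ → InConv-trans p v p⊆v , InConv-trans v p v⊆p

  StrictlyDecreasing⇒Injective : ∀ {n} {r : Fin n → Carrier} → StrictlyDecreasing r → Injective _≡_ _≡_ r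
  StrictlyDecreasing⇒Injective r↓ {i} {j} rᵢ≡rⱼ with ℕ.<-cmp (toℕ i) (toℕ j)
  ... | tri< i<j _ _ = ⊥-elim (<-irrefl (sym rᵢ≡rⱼ) (r↓ i j i<j))
  ... | tri≈ _ i≡j _ = toℕ-injective i≡j
  ... | tri> _ _ j<i = ⊥-elim (<-irrefl rᵢ≡rⱼ (r↓ j i j<i))

  vpt-affinelyIndependent : ∀ {d} (ξ : Pt d) (r : Fin (suc d) → Carrier) → Injective _≡_ _≡_ r →
    (∀ i → q ξ (r i) ≢ 0#) → AffinelyIndependent (λ i → vpt ξ (r i))
  vpt-affinelyIndependent {d} ξ r r-injective q≢0 c _ coords i =
    x*y≡0⇒x≡0 (vandermonde d r r-injective (λ i → c i * q ξ (r i) ⁻¹) moments i) (⁻¹≢0 (q≢0 i))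
    where
    moments : ∀ j → j ℕ.≤ d → ∑ (λ i → c i * q ξ (r i) ⁻¹ * r i ^ j) ≡ 0#
    moments j j≤d = trans (∑-cong reorder) (coords J)
      where
      J : Fin (suc d)
      J = fromℕ< (s≤s j≤d)
      toN-J : toN J ≡ j
      toN-J = trans (toN≡toℕ J) (toℕ-fromℕ< _)
      reorder : ∀ i → c i * q ξ (r i) ⁻¹ * r i ^ j ≡ c i * vpt ξ (r i) J
      reorder i = begin
        c i * q ξ (r i) ⁻¹ * r i ^ j
          ≡⟨ cong (λ e → c i * q ξ (r i) ⁻¹ * r i ^ e) toN-J ⟨
        c i * q ξ (r i) ⁻¹ * r i ^ toN J
          ≡⟨ solve 3 (λ c q⁻¹ P → c :* q⁻¹ :* P := c :* (P :* q⁻¹)) refl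
            (c i) (q ξ (r i) ⁻¹) (r i ^ toN J) ⟩
        c i * (r i ^ toN J * q ξ (r i) ⁻¹) ∎

  vpt-∈-hull : ∀ {d} (ξ : Pt d) (r : Fin (suc d) → Carrier) → StrictlyDecreasing r → (∀ i → q ξ (r i) ≢ 0#) →
    (∀ i → signum (q ξ (r i)) ≡ alt (toℕ i) · signum (q ξ (r zero))) →
    ∀ {x} → r zero < x → signum (q ξ x) ≡ signum (q ξ (r zero)) → InConv (λ i → vpt ξ (r i)) (vpt ξ x)
  vpt-∈-hull {d} ξ r r↓ q≢0 q-alternates {x} r₀<x qx-sign with interpolation d r r↓ r₀<x
  ... | μ , μ-interpolates , μ-alternates = w , w≥0 , ∑w≡1 , coords
    where
    Q : Carrier → Carrier
    Q = q ξ

    S : Sgn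
    S = signum (Q (r zero))

    S≢nil : S ≢ nil
    S≢nil = ≢0⇒signum≢nil (q≢0 zero)

    Qx≢0 : Q x ≢ 0#
    Qx≢0 Qx≡0 = S≢nil (trans (sym qx-sign) (signum-unique (is-nil Qx≡0)))

    w : Fin (suc d) → Carrier
    w i = μ i * Q (r i) * Q x ⁻¹

    w≥0 : ∀ i → 0# ≤ w i
    w≥0 i = inj₁ (signum≡pos⇒0< (begin
      signum (μ i * Q (r i) * Q x ⁻¹)
        ≡⟨ trans (signum-* _ _) (cong (_· signum (Q x ⁻¹)) (signum-* _ _)) ⟩
      signum (μ i) · signum (Q (r i)) · signum (Q x ⁻¹)
        ≡⟨ cong₂ _·_ (cong₂ _·_ (μ-alternates i) (q-alternates i))
          (trans (signum-⁻¹ Qx≢0) qx-sign) ⟩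
      alt (toℕ i) · (alt (toℕ i) · S) · S
        ≡⟨ cong (_· S) (·-cancelˡ (alt (toℕ i)) S (alt≢nil (toℕ i))) ⟩
      S · S
        ≡⟨ ·-square S S≢nil ⟩
      pos ∎))

    ∑w≡1 : ∑ w ≡ 1#
    ∑w≡1 = begin
      ∑ (λ i → μ i * Q (r i) * Q x ⁻¹)   ≡⟨ ∑-*ʳ (Q x ⁻¹) (λ i → μ i * Q (r i)) ⟩
      ∑ (λ i → μ i * Q (r i)) * Q x ⁻¹   ≡⟨ cong (_* Q x ⁻¹) (μ-interpolates Q (Degree≤-q ξ)) ⟩
      Q x * Q x ⁻¹                       ≡⟨ inverseʳ (Q x) Qx≢0 ⟩
      1#                                 ∎

    coords : ∀ j → vpt ξ x j ≡ ∑ (λ i → w i * vpt ξ (r i) j)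
    coords j = sym (begin
      ∑ (λ i → w i * (r i ^ toN j * Q (r i) ⁻¹))
        ≡⟨ ∑-cong cancel ⟩
      ∑ (λ i → μ i * r i ^ toN j * Q x ⁻¹)
        ≡⟨ ∑-*ʳ (Q x ⁻¹) (λ i → μ i * r i ^ toN j) ⟩
      ∑ (λ i → μ i * r i ^ toN j) * Q x ⁻¹
        ≡⟨ cong (_* Q x ⁻¹) (μ-interpolates (_^ toN j)
          (Degree≤-mono (toN≤pred j) (Degree≤-^ (toN j)))) ⟩
      x ^ toN j * Q x ⁻¹ ∎)
      where
      cancel : ∀ i → w i * (r i ^ toN j * Q (r i) ⁻¹) ≡ μ i * r i ^ toN j * Q x ⁻¹
      cancel i = begin
        μ i * Q (r i) * Q x ⁻¹ * (r i ^ toN j * Q (r i) ⁻¹)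
          ≡⟨ solve 5 (λ μ Q Qx⁻¹ P Q⁻¹ →
            μ :* Q :* Qx⁻¹ :* (P :* Q⁻¹) := μ :* P :* Qx⁻¹ :* (Q :* Q⁻¹))
            refl (μ i) (Q (r i)) (Q x ⁻¹) (r i ^ toN j) (Q (r i) ⁻¹) ⟩
        μ i * r i ^ toN j * Q x ⁻¹ * (Q (r i) * Q (r i) ⁻¹)
          ≡⟨ cong (μ i * r i ^ toN j * Q x ⁻¹ *_) (inverseʳ _ (q≢0 i)) ⟩
        μ i * r i ^ toN j * Q x ⁻¹ * 1#
          ≡⟨ *-identityʳ _ ⟩
        μ i * r i ^ toN j * Q x ⁻¹ ∎

  signum-corners : ∀ {d n} (d≤n : d ℕ.≤ n) (Q : Fin (suc n) → Carrier) → (∀ k → Q k ≢ 0#) →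
    AlternatesUpTo d (positive ∘ Q) →
    ∀ k → k ℕ.≤ d → signum (Q (corner d≤n k)) ≡ alt k · signum (Q (corner d≤n 0))
  signum-corners d≤n Q Q≢0 alternates zero    _   = refl
  signum-corners d≤n Q Q≢0 alternates (suc k) k<d = begin
    signum (Q (corner d≤n (suc k)))
      ≡⟨ signum-positive (Q≢0 _) ⟩
    sgnᵇ (positive (Q (corner d≤n (suc k))))
      ≡⟨ sgnᵇ-≢ (≢-sym (alternates (corner d≤n (suc k)) (corner d≤n k) (corner-adjacent d≤n k<d) corner-k≤d)) ⟩
    opp (sgnᵇ (positive (Q (corner d≤n k))))
      ≡⟨ cong opp (signum-positive (Q≢0 _)) ⟨
    opp (signum (Q (corner d≤n k)))
      ≡⟨ cong opp (signum-corners d≤n Q Q≢0 alternates k (ℕ.<⇒≤ k<d)) ⟩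
    opp (alt k · S)
      ≡⟨ opp-· (alt k) S ⟩
    alt (suc k) · S ∎
    where
    S : Sgn
    S = signum (Q (corner d≤n 0))
    corner-k≤d : toℕ (corner d≤n k) ℕ.≤ _
    corner-k≤d = subst (ℕ._≤ _) (sym (toℕ-corner d≤n k)) (ℕ.m∸n≤m _ k)

  signum-beyond : ∀ {d n} (d≤n : d ℕ.≤ n) (Q : Fin (suc n) → Carrier) → (∀ k → Q k ≢ 0#) →
    ConstantFrom d (positive ∘ Q) → ∀ k → d ℕ.≤ toℕ k → signum (Q k) ≡ signum (Q (corner d≤n 0))
  signum-beyond d≤n Q Q≢0 constant k d≤k = begin
    signum (Q k)
      ≡⟨ signum-positive (Q≢0 k) ⟩
    sgnᵇ (positive (Q k))
      ≡⟨ cong sgnᵇ (constant k (corner d≤n 0) d≤k (ℕ.≤-reflexive (sym (toℕ-corner d≤n 0)))) ⟩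
    sgnᵇ (positive (Q (corner d≤n 0)))
      ≡⟨ signum-positive (Q≢0 _) ⟨
    signum (Q (corner d≤n 0)) ∎

  simplex-of-sign-pattern : ∀ {d n} (t : Fin (suc n) → Carrier) → StrictlyIncreasing t → d ℕ.≤ n →
    (ξ : Pt d) → (∀ k → q ξ (t k) ≢ 0#) →
    AlternatesUpTo d (λ k → positive (q ξ (t k))) → ConstantFrom d (λ k → positive (q ξ (t k))) →
    IsDSimplex d (λ k → vpt ξ (t k))
  simplex-of-sign-pattern {d} t t↑ d≤n ξ q≢0 alternates constant =
    IsDSimplex-intro p v (vpt-affinelyIndependent ξ r (StrictlyDecreasing⇒Injective r↓) (q≢0 ∘ c ∘ toℕ))
      (λ i → InConv-vertex p (c (toℕ i))) p⊆v
    where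
    c : ℕ → Fin _
    c = corner d≤n

    p : Fin _ → Pt d
    p k = vpt ξ (t k)

    r : Fin (suc d) → Carrier
    r i = t (c (toℕ i))

    v : Fin (suc d) → Pt d
    v i = vpt ξ (r i)

    t↑ℕ : ∀ k k′ → toℕ k ℕ.< toℕ k′ → t k < t k′
    t↑ℕ k k′ k<k′ = t↑ k k′ (subst₂ ℕ._<_ (sym (toN≡toℕ k)) (sym (toN≡toℕ k′)) k<k′)

    r↓ : StrictlyDecreasing r
    r↓ i j i<j = t↑ℕ _ _ (subst₂ ℕ._<_ (sym (toℕ-corner d≤n (toℕ j))) (sym (toℕ-corner d≤n (toℕ i)))
                            (ℕ.∸-monoʳ-< i<j (toℕ≤pred[n] j)))

    p⊆v : ∀ k → InConv v (p k)
    p⊆v k with toℕ k ℕ.≤? d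
    ... | yes k≤d = subst (λ k′ → InConv v (p k′)) (trans (cong c (toℕ-fromℕ< i<1+d)) (corner-∸ d≤n k k≤d))
                      (InConv-vertex v (fromℕ< i<1+d))
      where
      i<1+d : d ∸ toℕ k ℕ.< suc d
      i<1+d = s≤s (ℕ.m∸n≤m d (toℕ k))
    ... | no k≰d  = vpt-∈-hull ξ r r↓ (q≢0 ∘ c ∘ toℕ)
                      (λ i → signum-corners d≤n (q ξ ∘ t) q≢0 alternates (toℕ i) (toℕ≤pred[n] i))
                      (t↑ℕ (c 0) k (subst (ℕ._< toℕ k) (sym (toℕ-corner d≤n 0)) (ℕ.≰⇒> k≰d)))
                      (signum-beyond d≤n (q ξ ∘ t) q≢0 constant k (ℕ.<⇒≤ (ℕ.≰⇒> k≰d)))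

theorem3p18 : (R : Reals) → let open Reals R in let open Geometry R in
    (d n : ℕ) → 3 ≤ℕ d → suc d ≤ℕ n →
    (t : Fin n → Carrier) → StrictlyIncreasing t →
    (ξ : Fin (suc d) → Carrier) → (∀ i → q ξ (t i) ≢ 0#) →
    runLengths (tabulate (λ i → positive (q ξ (t i)))) ≡ replicate d 1 ++ (n ∸ d) ∷ [] →
    IsDSimplex d (λ i → vpt ξ (t i))
theorem3p18 R d (suc n) _ (s≤s d≤n) t t↑ ξ q≢0 sign-pattern =
  let alternates , constant = runLengths-pattern d _ (suc n ∸ d) sign-pattern
  in  Veronese.simplex-of-sign-pattern R t t↑ d≤n ξ q≢0 alternates constant
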